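{- For $k\ge 1$ let $f(k)$ denote the maximum, over all outerplanar graphs $G$ and pairs of distinct vertices $u,v$ of $G$, of the number of paths in $G$ with $k$ edges whose endvertices are $u$ and $v$; set $f(0):=1$. Let $g(k)$ denote the same maximum taken only over pairs $u,v$ that are consecutive on the outer face of an outerplanar embedding of $G$. Then for every $k\ge 1$, $$f(k)\le \sum_{r=1}^{k} 2\,g(r)\,f(k-r).$$
   Context: A graph is outerplanar if it has a planar embedding with all vertices on the outer face (outerplanar embedding). -}

module Defs where

open import Data.Nat using (ℕ; zero; suc; _+_; _*_; _∸_; _≤_; _<_)
open import Data.Nat.ListAction using (sum)
open import Data.Bool using (Bool; true; false; T; _∧_; not)
open import Data.Fin using (Fin; toℕ; _≟_)
open import Data.Vec using (Vec; []; _∷_)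
open import Data.List using (List; []; _∷_; length; filterᵇ; map; concatMap; upTo)
open import Data.List.Base using (allFin)
open import Data.Product using (Σ; _×_; ∃; ∃-syntax; _,_)
open import Data.Sum using (_⊎_)
open import Relation.Nullary using (¬_; does)
open import Relation.Binary.PropositionalEquality using (_≡_; _≢_)
open import Function.Definitions using (Injective)

record Graph : Set where
  field
    n     : ℕ
    adj   : Fin n → Fin n → Bool
    sym   : ∀ x y → adj x y ≡ adj y x
    irrefl : ∀ x → adj x x ≡ false
open Graph public

-- An outerplanar embedding, combinatorially: an injective placement of the
-- vertices at positions 0..n-1 around a circle such that no two edges
-- (drawn as chords) cross, i.e. no edges ab, cd with pos a < pos c < pos b < pos d.
NonCrossing : (G : Graph) → (Fin (n G) → Fin (n G)) → Set
NonCrossing G pos = ∀ a b c d → T (adj G a b) → T (adj G c d) →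
  ¬ (toℕ (pos a) < toℕ (pos c) × toℕ (pos c) < toℕ (pos b) × toℕ (pos b) < toℕ (pos d))

record OuterplanarEmbedding (G : Graph) : Set where
  field
    pos       : Fin (n G) → Fin (n G)
    pos-inj   : Injective _≡_ _≡_ pos
    noncross  : NonCrossing G pos
open OuterplanarEmbedding public

Outerplanar : Graph → Set
Outerplanar G = OuterplanarEmbedding G

Follows : (m : ℕ) → Fin m → Fin m → Set
Follows m i j = (suc (toℕ i) ≡ toℕ j) ⊎ (suc (toℕ i) ≡ m × toℕ j ≡ 0)

Consecutive : (G : Graph) → OuterplanarEmbedding G → Fin (n G) → Fin (n G) → Set
Consecutive G E u v = Follows (n G) (pos E u) (pos E v) ⊎ Follows (n G) (pos E v) (pos E u)

-- Counting paths with k edges from u to v (as vertex sequences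
-- x₀ = u, x₁, …, x_k = v, pairwise distinct, consecutive ones adjacent).

allVecs : (m len : ℕ) → List (Vec (Fin m) len)
allVecs m zero = [] ∷ []
allVecs m (suc len) = concatMap (λ x → map (x ∷_) (allVecs m len)) (allFin m)

notIn : ∀ {m len} → Fin m → Vec (Fin m) len → Bool
notIn x [] = true
notIn x (y ∷ ys) = not (does (x ≟ y)) ∧ notIn x ys

distinct : ∀ {m len} → Vec (Fin m) len → Bool
distinct [] = true
distinct (x ∷ xs) = notIn x xs ∧ distinct xs

walkTo : (G : Graph) → ∀ {len} → Fin (n G) → Vec (Fin (n G)) (suc len) → Bool
walkTo G v (x ∷ []) = does (x ≟ v)
walkTo G v (x ∷ y ∷ ys) = adj G x y ∧ walkTo G v (y ∷ ys)

isPath : (G : Graph) (u v : Fin (n G)) (k : ℕ) → Vec (Fin (n G)) (suc k) → Bool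
isPath G u v k (x ∷ xs) = does (x ≟ u) ∧ walkTo G v (x ∷ xs) ∧ distinct (x ∷ xs)

numPaths : (G : Graph) (u v : Fin (n G)) (k : ℕ) → ℕ
numPaths G u v k = length (filterᵇ (isPath G u v k) (allVecs (n G) (suc k)))

IsF : (ℕ → ℕ) → Set
IsF F = F 0 ≡ 1 ×
  (∀ k → 1 ≤ k →
    (∀ (G : Graph) → Outerplanar G → (u v : Fin (n G)) → u ≢ v → numPaths G u v k ≤ F k) ×
    (∃[ G ] (Outerplanar G × Σ (Fin (n G)) λ u → Σ (Fin (n G)) λ v → u ≢ v × numPaths G u v k ≡ F k)))

IsG : (ℕ → ℕ) → Set
IsG Gf =
  ∀ k → 1 ≤ k →
    (∀ (G : Graph) (E : OuterplanarEmbedding G) (u v : Fin (n G)) → u ≢ v → Consecutive G E u v →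
       numPaths G u v k ≤ Gf k) ×
    (∃[ G ] Σ (OuterplanarEmbedding G) λ E → Σ (Fin (n G)) λ u → Σ (Fin (n G)) λ v →
       u ≢ v × Consecutive G E u v × numPaths G u v k ≡ Gf k)

recSum : (F Gf : ℕ → ℕ) → ℕ → ℕ
recSum F Gf k = sum (map (λ r′ → 2 * Gf (suc r′) * F (k ∸ suc r′)) (upTo k))

{-# OPTIONS --safe #-}
-- Rotate the embedding so that u sits at position 0, let b be the position of v, and consider
-- first the u–v paths whose first step lands at a position ≤ b. Let y be the neighbour of u with
-- the largest position m ≤ b. No edge crosses the chord u y, so such a path stays strictly between
-- positions 0 and m until it reaches y. Its part up to y, of r + 1 edges say, is a u–y path in the
-- subgraph spanned by the arc of positions 0, …, m, in which u and y are consecutive on the outer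
-- face: at most g(r + 1) choices. The rest is a y–v path with k − r − 1 edges: at most f(k − r − 1)
-- choices. Summing over r bounds these paths by Σ g(r) f(k − r), and the reflection q ↦ −q (mod n)
-- of the positions turns the remaining paths into paths of the same kind, whence the factor 2.
module Submission where

open import Defs hiding (sym)
open import Data.Bool using (Bool; true; false; T; not; _∧_)
open import Data.Bool.Properties using (T-∧; ∧-comm)
open import Data.Empty using (⊥-elim)
open import Data.Fin using (Fin; toℕ; fromℕ<; _≟_)
open import Data.Fin.Permutation.Components using (transpose; transpose-inverse)
open import Data.Fin.Properties using (toℕ-fromℕ<; toℕ-injective; toℕ<n)
open import Data.List as List using (List; []; _∷_; _++_; length; map; filterᵇ; concatMap; allFin; upTo)
open import Data.List.Extrema.Nat using (argmax; argmax-all; f[⊥]≤f[argmax]; f[xs]≤f[argmax])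
open import Data.List.Membership.Propositional using (_∈_; lose)
open import Data.List.Membership.Propositional.Properties
  using (∈-allFin; ∈-filter⁺; ∈-map⁺; ∈-upTo⁺; ∈-upTo⁻)
open import Data.List.Properties
  using (length-++; length-filter; filter-++; filter-none; filter-≐; map-cong; ++-assoc)
open import Data.List.Relation.Unary.All as All using (All; []; _∷_; universal)
open import Data.List.Relation.Unary.All.Properties using (all-filter; ++⁺)
open import Data.List.Relation.Unary.Any using (Any; here; there)
open import Data.Nat
  using (ℕ; zero; suc; _+_; _*_; _∸_; _<_; _≤_; _≤ᵇ_; z≤n; s≤s; s≤s⁻¹; z<s; pred; NonZero; >-nonZero)
open import Data.Nat.ListAction using (sum)
open import Data.Nat.Properties hiding (_≟_)
open import Data.Product using (Σ-syntax; ∃; ∃₂; _×_; _,_; proj₁; proj₂)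
open import Data.Sum using (_⊎_; inj₁; inj₂)
open import Data.Vec as Vec using (Vec; []; _∷_; toList)
open import Data.Vec.Properties using (length-toList)
open import Function using (_∘_; case_of_; Equivalence)
open import Relation.Binary.PropositionalEquality
open import Relation.Nullary using (¬_; Dec; yes; no; does; contradiction)
open import Relation.Nullary.Decidable using (T?; dec-true; dec-false)

open Equivalence using (to; from)

private
  variable
    A B : Set

does-sound : ∀ {P : Set} (p? : Dec P) → T (does p?) → P
does-sound (yes p) _ = p

does-complete : ∀ {P : Set} (p? : Dec P) → P → T (does p?)
does-complete (yes _) _ = _
does-complete (no ¬p) p = ¬p p

not-does-sound : ∀ {P : Set} (p? : Dec P) → T (not (does p?)) → ¬ P
not-does-sound (no ¬p) _ = ¬p

module _ (p : A → Bool) where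

  length-filterᵇ-++ : ∀ xs ys →
    length (filterᵇ p (xs ++ ys)) ≡ length (filterᵇ p xs) + length (filterᵇ p ys)
  length-filterᵇ-++ xs ys = trans (cong length (filter-++ _ xs ys)) (length-++ (filterᵇ p xs))

  length-filterᵇ-map : (f : B → A) → ∀ xs →
    length (filterᵇ p (map f xs)) ≡ length (filterᵇ (p ∘ f) xs)
  length-filterᵇ-map f [] = refl
  length-filterᵇ-map f (x ∷ xs) with p (f x)
  ... | true  = cong suc (length-filterᵇ-map f xs)
  ... | false = length-filterᵇ-map f xs

  length-filterᵇ-concatMap : (f : B → List A) → ∀ xs →
    length (filterᵇ p (concatMap f xs)) ≡ sum (map (λ x → length (filterᵇ p (f x))) xs)
  length-filterᵇ-concatMap f [] = refl
  length-filterᵇ-concatMap f (x ∷ xs) =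
    trans (length-filterᵇ-++ (f x) (concatMap f xs))
          (cong (length (filterᵇ p (f x)) +_) (length-filterᵇ-concatMap f xs))

  length-filterᵇ-≤-split : (q : A → Bool) → ∀ xs →
    length (filterᵇ p xs) ≤ length (filterᵇ q xs) + length (filterᵇ (λ x → p x ∧ not (q x)) xs)
  length-filterᵇ-≤-split q [] = z≤n
  length-filterᵇ-≤-split q (x ∷ xs) with p x | q x
  ... | true  | true  = s≤s (length-filterᵇ-≤-split q xs)
  ... | true  | false = ≤-trans (s≤s (length-filterᵇ-≤-split q xs))
                                (≤-reflexive (sym (+-suc (length (filterᵇ q xs)) _)))
  ... | false | true  = m≤n⇒m≤1+n (length-filterᵇ-≤-split q xs)
  ... | false | false = length-filterᵇ-≤-split q xs

  length-filterᵇ-none : (∀ x → ¬ T (p x)) → ∀ xs → length (filterᵇ p xs) ≡ 0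
  length-filterᵇ-none never xs = cong length (filter-none (T? ∘ p) (universal never xs))

length-filterᵇ-cover : (p : A → Bool) (q : B → A → Bool) (rs : List B) →
  (∀ x → T (p x) → Any (λ r → T (q r x)) rs) → ∀ xs →
  length (filterᵇ p xs) ≤ sum (map (λ r → length (filterᵇ (q r) xs)) rs)
length-filterᵇ-cover p q [] cover xs =
  ≤-reflexive (length-filterᵇ-none p (λ x px → case cover x px of λ ()) xs)
length-filterᵇ-cover p q (r ∷ rs) cover xs =
  ≤-trans (length-filterᵇ-≤-split p (q r) xs)
          (+-monoʳ-≤ _ (length-filterᵇ-cover _ q rs cover′ xs))
  where
  cover′ : ∀ x → T (p x ∧ not (q r x)) → Any (λ r → T (q r x)) rs
  cover′ x t with to (T-∧ {p x}) t
  ... | px , ¬qrx with cover x px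
  ...   | there any = any
  ...   | here qrx with q r x
  ...     | true = ⊥-elim ¬qrx

∈⇒≤sum : ∀ {n ns} → n ∈ ns → n ≤ sum ns
∈⇒≤sum {ns = n ∷ ns} (here refl)  = m≤m+n n (sum ns)
∈⇒≤sum {ns = m ∷ ns} (there n∈ns) = ≤-trans (∈⇒≤sum n∈ns) (m≤n+m (sum ns) m)

sum-map-mono : ∀ {f g : A → ℕ} xs → (∀ {x} → x ∈ xs → f x ≤ g x) → sum (map f xs) ≤ sum (map g xs)
sum-map-mono []       f≤g = z≤n
sum-map-mono (x ∷ xs) f≤g = +-mono-≤ (f≤g (here refl)) (sum-map-mono xs (f≤g ∘ there))

sum-map-*ˡ : (c : ℕ) (f : A → ℕ) → ∀ xs → sum (map (λ x → c * f x) xs) ≡ c * sum (map f xs)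
sum-map-*ˡ c f [] = sym (*-zeroʳ c)
sum-map-*ˡ c f (x ∷ xs) =
  trans (cong (c * f x +_) (sum-map-*ˡ c f xs)) (sym (*-distribˡ-+ c (f x) (sum (map f xs))))

sum-map-*ʳ : (f : A → ℕ) (c : ℕ) → ∀ xs → sum (map (λ x → f x * c) xs) ≡ sum (map f xs) * c
sum-map-*ʳ f c [] = refl
sum-map-*ʳ f c (x ∷ xs) =
  trans (cong (f x * c +_) (sum-map-*ʳ f c xs)) (sym (*-distribʳ-+ c (f x) (sum (map f xs))))

count : ∀ {m} len → (Vec (Fin m) len → Bool) → ℕ
count {m} len p = length (filterᵇ p (allVecs m len))

module _ {m : ℕ} where

  count-∷ : ∀ {len} (p : Vec (Fin m) (suc len) → Bool) →
    count (suc len) p ≡ sum (map (λ x → count len (p ∘ (x ∷_))) (allFin m))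
  count-∷ {len} p =
    trans (length-filterᵇ-concatMap p (λ x → map (x ∷_) (allVecs m len)) (allFin m))
          (cong sum (map-cong (λ x → length-filterᵇ-map p (x ∷_) (allVecs m len)) (allFin m)))

  count-cong : ∀ {len} {p q : Vec (Fin m) len → Bool} → (∀ w → p w ≡ q w) → count len p ≡ count len q
  count-cong {len} {p} {q} p≗q = cong length (filter-≐ (T? ∘ p) (T? ∘ q) p⇔q (allVecs m len))
    where
    p⇔q : (∀ {w} → T (p w) → T (q w)) × (∀ {w} → T (q w) → T (p w))
    p⇔q = (λ {w} → subst T (p≗q w)) , (λ {w} → subst T (sym (p≗q w)))

  count-∷-≤ : ∀ {len} (p : Vec (Fin m) (suc len) → Bool) x → count len (p ∘ (x ∷_)) ≤ count (suc len) p
  count-∷-≤ p x = ≤-trans (∈⇒≤sum (∈-map⁺ (λ x → count _ (p ∘ (x ∷_))) (∈-allFin x)))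
                          (≤-reflexive (sym (count-∷ p)))

  count-++ : ∀ a {b} (p : Vec (Fin m) a → Bool) (q : Vec (Fin m) b → Bool) →
    count (a + b) (λ w → p (Vec.take a w) ∧ q (Vec.drop a w)) ≡ count a p * count b q
  count-++ zero {b} p q with p []
  ... | true  = sym (+-identityʳ _)
  ... | false = length-filterᵇ-none _ (λ _ ()) (allVecs m b)
  count-++ (suc a) {b} p q = begin
    count (suc a + b) (λ w → p (Vec.take (suc a) w) ∧ q (Vec.drop (suc a) w))
      ≡⟨ count-∷ _ ⟩
    sum (map (λ x → count (a + b) (λ w → p (x ∷ Vec.take a w) ∧ q (Vec.drop a w))) (allFin m))
      ≡⟨ cong sum (map-cong (λ x → count-++ a (p ∘ (x ∷_)) q) (allFin m)) ⟩
    sum (map (λ x → count a (p ∘ (x ∷_)) * count b q) (allFin m))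
      ≡⟨ sum-map-*ʳ (λ x → count a (p ∘ (x ∷_))) (count b q) (allFin m) ⟩
    sum (map (λ x → count a (p ∘ (x ∷_))) (allFin m)) * count b q
      ≡⟨ cong (_* count b q) (count-∷ p) ⟨
    count (suc a) p * count b q
      ∎
    where open ≡-Reasoning

maximum? : ∀ {m} (P : Fin m → Bool) (f : Fin m → ℕ) →
  (∀ x → ¬ T (P x)) ⊎ ∃ λ y → T (P y) × (∀ x → T (P x) → f x ≤ f y)
maximum? {m} P f with filterᵇ P (allFin m) in eq
... | [] = inj₁ λ x Px → case subst (x ∈_) eq (∈-filter⁺ (T? ∘ P) (∈-allFin x) Px) of λ ()
... | x ∷ xs = inj₂ (argmax f x xs , argmax-all f Px Pxs , λ z Pz →
                    All.lookup (f[⊥]≤f[argmax] {f = f} x xs ∷ f[xs]≤f[argmax] {f = f} x xs)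
                               (subst (z ∈_) eq (∈-filter⁺ (T? ∘ P) (∈-allFin z) Pz)))
  where
  Px∷Pxs : All (T ∘ P) (x ∷ xs)
  Px∷Pxs = subst (All (T ∘ P)) eq (all-filter (T? ∘ P) (allFin m))
  Px : T (P x)
  Px = All.head Px∷Pxs
  Pxs : All (T ∘ P) xs
  Pxs = All.tail Px∷Pxs

walkToL : (G : Graph) → Fin (n G) → List (Fin (n G)) → Bool
walkToL G v []           = false
walkToL G v (x ∷ [])     = does (x ≟ v)
walkToL G v (x ∷ y ∷ ys) = adj G x y ∧ walkToL G v (y ∷ ys)

notInL : ∀ {m} → Fin m → List (Fin m) → Bool
notInL x []       = true
notInL x (y ∷ ys) = not (does (x ≟ y)) ∧ notInL x ys

distinctL : ∀ {m} → List (Fin m) → Bool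
distinctL []       = true
distinctL (x ∷ xs) = notInL x xs ∧ distinctL xs

isPathL : (G : Graph) (u v : Fin (n G)) → List (Fin (n G)) → Bool
isPathL G u v []       = false
isPathL G u v (x ∷ xs) = does (x ≟ u) ∧ walkToL G v (x ∷ xs) ∧ distinctL (x ∷ xs)

notIn-toList : ∀ {m len} (x : Fin m) (w : Vec (Fin m) len) → notIn x w ≡ notInL x (toList w)
notIn-toList x []      = refl
notIn-toList x (y ∷ w) = cong (not (does (x ≟ y)) ∧_) (notIn-toList x w)

distinct-toList : ∀ {m len} (w : Vec (Fin m) len) → distinct w ≡ distinctL (toList w)
distinct-toList []      = refl
distinct-toList (x ∷ w) = cong₂ _∧_ (notIn-toList x w) (distinct-toList w)

notInL-++⁻ˡ : ∀ {m} (a : Fin m) xs {ys} → T (notInL a (xs ++ ys)) → T (notInL a xs)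
notInL-++⁻ˡ a []       _ = _
notInL-++⁻ˡ a (x ∷ xs) t with to (T-∧ {not (does (a ≟ x))}) t
... | a≢x , rest = from T-∧ (a≢x , notInL-++⁻ˡ a xs rest)

distinctL-++⁻ : ∀ {m} (xs : List (Fin m)) {ys} →
  T (distinctL (xs ++ ys)) → T (distinctL xs) × T (distinctL ys)
distinctL-++⁻ []       t = _ , t
distinctL-++⁻ (x ∷ xs) t with to (T-∧ {notInL x (xs ++ _)}) t
... | x∉ , rest with distinctL-++⁻ xs rest
...   | dxs , dys = from T-∧ (notInL-++⁻ˡ x xs x∉ , dxs) , dys

restrict : (G : Graph) → (Fin (n G) → Bool) → Graph
restrict G S = record
  { n      = n G
  ; adj    = λ x z → adj G x z ∧ (S x ∧ S z)
  ; sym    = λ x z → cong₂ _∧_ (Graph.sym G x z) (∧-comm (S x) (S z))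
  ; irrefl = λ x → cong (_∧ (S x ∧ S x)) (irrefl G x)
  }

module _ (G : Graph) where

  walkTo-toList : ∀ v {len} (w : Vec (Fin (n G)) (suc len)) → walkTo G v w ≡ walkToL G v (toList w)
  walkTo-toList v (x ∷ [])     = refl
  walkTo-toList v (x ∷ y ∷ ys) = cong (adj G x y ∧_) (walkTo-toList v (y ∷ ys))

  isPath-toList : ∀ u v k (P : Vec (Fin (n G)) (suc k)) → isPath G u v k P ≡ isPathL G u v (toList P)
  isPath-toList u v k (x ∷ w) =
    cong (does (x ≟ u) ∧_) (cong₂ _∧_ (walkTo-toList v (x ∷ w)) (distinct-toList (x ∷ w)))

  isPathL-intro : ∀ {u v} xs →
    T (walkToL G v (u ∷ xs)) → T (distinctL (u ∷ xs)) → T (isPathL G u v (u ∷ xs))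
  isPathL-intro {u} {v} xs w d =
    from T-∧ (does-complete (u ≟ u) refl , from (T-∧ {walkToL G v (u ∷ xs)}) (w , d))

  isPathL-elim : ∀ u v x xs → T (isPathL G u v (x ∷ xs)) →
    x ≡ u × T (walkToL G v (x ∷ xs)) × T (distinctL (x ∷ xs))
  isPathL-elim u v x xs t with to (T-∧ {does (x ≟ u)}) t
  ... | x≡u , rest = does-sound (x ≟ u) x≡u , to (T-∧ {walkToL G v (x ∷ xs)}) rest

  walkToL-++ : ∀ {v y} xs {ys} → T (walkToL G v (xs ++ y ∷ ys)) →
    T (walkToL G y (xs ++ y ∷ [])) × T (walkToL G v (y ∷ ys))
  walkToL-++ {y = y} []       w = does-complete (y ≟ y) refl , w
  walkToL-++ {y = y} (x ∷ []) w with to (T-∧ {adj G x y}) w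
  ... | xy , rest = from T-∧ (xy , does-complete (y ≟ y) refl) , rest
  walkToL-++ (x ∷ z ∷ xs) w =
    let xz , rest = to (T-∧ {adj G x z}) w
        pre , suf = walkToL-++ (z ∷ xs) rest
    in from T-∧ (xz , pre) , suf

  walkToL-restrict : ∀ {S v} xs →
    All (T ∘ S) xs → T (walkToL G v xs) → T (walkToL (restrict G S) v xs)
  walkToL-restrict (x ∷ [])     _               w = w
  walkToL-restrict (x ∷ z ∷ xs) (Sx ∷ Sz ∷ Sxs) w =
    let xz , rest = to (T-∧ {adj G x z}) w
    in from T-∧ (from T-∧ (xz , from T-∧ (Sx , Sz)) , walkToL-restrict (z ∷ xs) (Sz ∷ Sxs) rest)

  walkToL-returns : ∀ {v} x y ys → T (walkToL G v (x ∷ y ∷ ys)) → ¬ T (notInL v (y ∷ ys))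
  walkToL-returns {v} x y [] w v∉ =
    not-does-sound (v ≟ y) (proj₁ (to T-∧ v∉))
                   (sym (does-sound (y ≟ v) (proj₂ (to (T-∧ {adj G x y}) w))))
  walkToL-returns {v} x y (z ∷ zs) w v∉ =
    walkToL-returns y z zs (proj₂ (to (T-∧ {adj G x y}) w))
                           (proj₂ (to (T-∧ {not (does (v ≟ y))}) v∉))

  isPathL-closed : ∀ {v} x y ys → ¬ T (isPathL G v v (x ∷ y ∷ ys))
  isPathL-closed {v} x y ys t with isPathL-elim v v x (y ∷ ys) t
  ... | refl , w , d = walkToL-returns x y ys w (proj₁ (to (T-∧ {notInL x (y ∷ ys)}) d))

take-++-∷ : ∀ (xs : List A) y ys → List.take (suc (length xs)) (xs ++ y ∷ ys) ≡ xs ++ y ∷ []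
take-++-∷ []       y ys = refl
take-++-∷ (x ∷ xs) y ys = cong (x ∷_) (take-++-∷ xs y ys)

drop-++-∷ : ∀ (xs : List A) y ys → List.drop (suc (length xs)) (xs ++ y ∷ ys) ≡ ys
drop-++-∷ []       y ys = refl
drop-++-∷ (x ∷ xs) y ys = drop-++-∷ xs y ys

toList-take : ∀ a {b} (w : Vec A (a + b)) → toList (Vec.take a w) ≡ List.take a (toList w)
toList-take zero    w       = refl
toList-take (suc a) (x ∷ w) = cong (x ∷_) (toList-take a w)

toList-drop : ∀ a {b} (w : Vec A (a + b)) → toList (Vec.drop a w) ≡ List.drop a (toList w)
toList-drop zero    w       = refl
toList-drop (suc a) (x ∷ w) = toList-drop a w

-- Moving vertices around the circle

NonCrossingℕ : (G : Graph) → (Fin (n G) → ℕ) → Set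
NonCrossingℕ G ψ =
  ∀ a b c d → T (adj G a b) → T (adj G c d) → ¬ (ψ a < ψ c × ψ c < ψ b × ψ b < ψ d)

module _ {G : Graph} where

  position : OuterplanarEmbedding G → Fin (n G) → ℕ
  position E x = toℕ (pos E x)

  position-injective : ∀ E {x z} → position E x ≡ position E z → x ≡ z
  position-injective E eq = pos-inj E (toℕ-injective eq)

  position< : ∀ E x → position E x < n G
  position< E x = toℕ<n (pos E x)

  reembed : (ψ : Fin (n G) → ℕ) → (∀ x → ψ x < n G) → (∀ {x z} → ψ x ≡ ψ z → x ≡ z) →
            NonCrossingℕ G ψ → Σ[ E ∈ OuterplanarEmbedding G ] (∀ x → position E x ≡ ψ x)
  reembed ψ ψ< ψ-inj nc =
    record { pos = pos′ ; pos-inj = pos′-inj ; noncross = noncross′ } , toℕ-pos′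
    where
    pos′ : Fin (n G) → Fin (n G)
    pos′ x = fromℕ< (ψ< x)

    toℕ-pos′ : ∀ x → toℕ (pos′ x) ≡ ψ x
    toℕ-pos′ x = toℕ-fromℕ< (ψ< x)

    pos′-inj : ∀ {x z} → pos′ x ≡ pos′ z → x ≡ z
    pos′-inj {x} {z} eq = ψ-inj (trans (sym (toℕ-pos′ x)) (trans (cong toℕ eq) (toℕ-pos′ z)))

    noncross′ : NonCrossing G pos′
    noncross′ a b c d ab cd rewrite toℕ-pos′ a | toℕ-pos′ b | toℕ-pos′ c | toℕ-pos′ d =
      nc a b c d ab cd

cyclicPred : ℕ → ℕ → ℕ
cyclicPred n zero    = pred n
cyclicPred n (suc q) = q

cyclicPred≤pred : ∀ {n q} → q < n → cyclicPred n q ≤ pred n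
cyclicPred≤pred {suc n} {zero}  _         = ≤-refl
cyclicPred≤pred {suc n} {suc q} (s≤s q<n) = <⇒≤ q<n

cyclicPred< : ∀ {n q} → q < n → cyclicPred n q < n
cyclicPred< {suc n} q<n = s≤s (cyclicPred≤pred q<n)

cyclicPred-injective : ∀ {n p q} → p < n → q < n → cyclicPred n p ≡ cyclicPred n q → p ≡ q
cyclicPred-injective {p = zero}  {zero}  _   _   _  = refl
cyclicPred-injective {p = zero}  {suc q} _   q<n eq =
  contradiction (sym eq) (<⇒≢ (suc[m]≤n⇒m≤pred[n] q<n))
cyclicPred-injective {p = suc p} {zero}  p<n _   eq =
  contradiction eq (<⇒≢ (suc[m]≤n⇒m≤pred[n] p<n))
cyclicPred-injective {p = suc p} {suc q} _   _   eq = cong suc eq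

cyclicPred-interleaving : ∀ {n a b c d} → b < n → c < n → d < n →
  cyclicPred n a < cyclicPred n c → cyclicPred n c < cyclicPred n b → cyclicPred n b < cyclicPred n d →
  (a < c × c < b × b < d) ⊎ (d < a × a < c × c < b)
cyclicPred-interleaving {a = zero} _ c<n _ ac _ _ =
  contradiction ac (≤⇒≯ (cyclicPred≤pred c<n))
cyclicPred-interleaving {a = suc _} {c = zero} b<n _ _ _ cb _ =
  contradiction cb (≤⇒≯ (cyclicPred≤pred b<n))
cyclicPred-interleaving {a = suc _} {zero} {suc _} _ _ d<n _ _ bd =
  contradiction bd (≤⇒≯ (cyclicPred≤pred d<n))
cyclicPred-interleaving {a = suc _} {suc _} {suc _} {zero}  _ _ _ ac cb _  = inj₂ (z<s , s≤s ac , s≤s cb)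
cyclicPred-interleaving {a = suc _} {suc _} {suc _} {suc _} _ _ _ ac cb bd = inj₁ (s≤s ac , s≤s cb , s≤s bd)

cyclicNeg : ℕ → ℕ → ℕ
cyclicNeg n zero    = 0
cyclicNeg n (suc q) = n ∸ suc q

cyclicNeg< : ∀ {n q} → q < n → cyclicNeg n q < n
cyclicNeg< {suc n} {zero}  _ = z<s
cyclicNeg< {suc n} {suc q} _ = s≤s (m∸n≤m n q)

cyclicNeg-positive : ∀ {n q} → 0 < q → q < n → 0 < cyclicNeg n q
cyclicNeg-positive {q = suc q} _ q<n = m<n⇒0<n∸m q<n

cyclicNeg-antitone : ∀ n {p q} → 0 < p → p < q → cyclicNeg n q ≤ cyclicNeg n p
cyclicNeg-antitone n {suc p} {suc q} _ p<q = ∸-monoʳ-≤ n (<⇒≤ p<q)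

cyclicNeg-injective : ∀ {n p q} → p < n → q < n → cyclicNeg n p ≡ cyclicNeg n q → p ≡ q
cyclicNeg-injective {p = zero}  {zero}  _   _   _  = refl
cyclicNeg-injective {p = zero}  {suc q} _   q<n eq =
  contradiction eq (<⇒≢ (cyclicNeg-positive z<s q<n))
cyclicNeg-injective {p = suc p} {zero}  p<n _   eq =
  contradiction (sym eq) (<⇒≢ (cyclicNeg-positive z<s p<n))
cyclicNeg-injective {p = suc p} {suc q} p<n q<n eq = ∸-cancelˡ-≡ (<⇒≤ p<n) (<⇒≤ q<n) eq

cyclicNeg-interleaving : ∀ {n a b c d} →
  cyclicNeg n a < cyclicNeg n c → cyclicNeg n c < cyclicNeg n b → cyclicNeg n b < cyclicNeg n d →
  (a < d × d < b × b < c) ⊎ (d < b × b < c × c < a)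
cyclicNeg-interleaving {c = zero} ()
cyclicNeg-interleaving {b = zero} {suc _} _ ()
cyclicNeg-interleaving {b = suc _} {suc _} {zero} _ _ ()
cyclicNeg-interleaving {n} {zero} {suc _} {suc _} {suc _} _ cb bd =
  inj₁ (z<s , ∸-cancelʳ-< {o = n} bd , ∸-cancelʳ-< {o = n} cb)
cyclicNeg-interleaving {n} {suc _} {suc _} {suc _} {suc _} ac cb bd =
  inj₂ (∸-cancelʳ-< {o = n} bd , ∸-cancelʳ-< {o = n} cb , ∸-cancelʳ-< {o = n} ac)

module _ {G : Graph} where

  rotate : (E : OuterplanarEmbedding G) →
    Σ[ E′ ∈ OuterplanarEmbedding G ] (∀ x → position E′ x ≡ cyclicPred (n G) (position E x))
  rotate E = reembed (cyclicPred (n G) ∘ position E) (λ x → cyclicPred< (position< E x))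
    (λ eq → position-injective E (cyclicPred-injective (position< E _) (position< E _) eq)) nc
    where
    nc : NonCrossingℕ G (cyclicPred (n G) ∘ position E)
    nc a b c d ab cd (ac , cb , bd)
      with cyclicPred-interleaving (position< E b) (position< E c) (position< E d) ac cb bd
    ... | inj₁ acbd = noncross E a b c d ab cd acbd
    ... | inj₂ dacb = noncross E d c a b (subst T (Graph.sym G c d) cd) ab dacb

  reflect : (E : OuterplanarEmbedding G) →
    Σ[ E′ ∈ OuterplanarEmbedding G ] (∀ x → position E′ x ≡ cyclicNeg (n G) (position E x))
  reflect E = reembed (cyclicNeg (n G) ∘ position E) (λ x → cyclicNeg< (position< E x))
    (λ eq → position-injective E (cyclicNeg-injective (position< E _) (position< E _) eq)) nc
    where
    nc : NonCrossingℕ G (cyclicNeg (n G) ∘ position E)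
    nc a b c d ab cd (ac , cb , bd) with cyclicNeg-interleaving ac cb bd
    ... | inj₁ adbc = noncross E a b d c ab (subst T (Graph.sym G c d) cd) adbc
    ... | inj₂ dbca =
      noncross E d c b a (subst T (Graph.sym G c d) cd) (subst T (Graph.sym G a b) ab) dbca

  placeFirst : (E : OuterplanarEmbedding G) (u : Fin (n G)) →
    Σ[ E′ ∈ OuterplanarEmbedding G ] position E′ u ≡ 0
  placeFirst E u = go (position E u) E refl
    where
    go : ∀ t E → position E u ≡ t → Σ[ E′ ∈ OuterplanarEmbedding G ] position E′ u ≡ 0
    go zero    E eq = E , eq
    go (suc t) E eq = let E′ , position-E′ = rotate E
                      in go t E′ (trans (position-E′ u) (cong (cyclicPred (n G)) eq))

transpose-matchˡ : ∀ {m} (i j : Fin m) → transpose i j i ≡ j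
transpose-matchˡ i j rewrite dec-true (i ≟ i) refl = refl

transpose-fix : ∀ {m} {i j k : Fin m} → k ≢ i → k ≢ j → transpose i j k ≡ k
transpose-fix {i = i} {j} {k} k≢i k≢j rewrite dec-false (k ≟ i) k≢i | dec-false (k ≟ j) k≢j = refl

transpose-injective : ∀ {m} (i j : Fin m) {k l} → transpose i j k ≡ transpose i j l → k ≡ l
transpose-injective i j eq =
  trans (sym (transpose-inverse j i)) (trans (cong (transpose j i) eq) (transpose-inverse j i))

module _ {G : Graph} where

  withinArc : OuterplanarEmbedding G → Fin (n G) → Fin (n G) → Bool
  withinArc E y x = position E x ≤ᵇ position E y

  module _ (E : OuterplanarEmbedding G) {u y : Fin (n G)}
           (u-first : position E u ≡ 0) (u≢y : u ≢ y) where

    private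
      m : ℕ
      m = position E y

      instance
        n-nonZero : NonZero (n G)
        n-nonZero = >-nonZero (≤-<-trans z≤n (position< E y))

      pred-n<n : pred (n G) < n G
      pred-n<n = ≤-reflexive (suc-pred (n G))

      last : Fin (n G)
      last = fromℕ< pred-n<n

      ψ : Fin (n G) → ℕ
      ψ x = toℕ (transpose (pos E y) last (pos E x))

      ψ-y : ψ y ≡ pred (n G)
      ψ-y = trans (cong toℕ (transpose-matchˡ (pos E y) last)) (toℕ-fromℕ< pred-n<n)

      ψ-fix : ∀ {x} → position E x ≤ m → x ≢ y → ψ x ≡ position E x
      ψ-fix {x} x≤m x≢y = cong toℕ (transpose-fix (x≢y ∘ pos-inj E) x≢last)
        where
        x<m : position E x < m
        x<m = ≤∧≢⇒< x≤m (x≢y ∘ position-injective E)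
        x≢last : pos E x ≢ last
        x≢last eq = <⇒≢ (<-≤-trans x<m (suc[m]≤n⇒m≤pred[n] (position< E y)))
                        (trans (cong toℕ eq) (toℕ-fromℕ< pred-n<n))

      ψ-reflects-< : ∀ {a c} → position E a ≤ m → position E c ≤ m →
                     ψ a < ψ c → position E a < position E c
      ψ-reflects-< {a} {c} a≤m c≤m lt with a ≟ y | c ≟ y
      ... | yes refl | _        =
        contradiction (subst (_< ψ c) ψ-y lt) (≤⇒≯ (suc[m]≤n⇒m≤pred[n] (toℕ<n _)))
      ... | no a≢y   | yes refl = ≤∧≢⇒< a≤m (a≢y ∘ position-injective E)
      ... | no a≢y   | no c≢y   = subst₂ _<_ (ψ-fix a≤m a≢y) (ψ-fix c≤m c≢y) lt

    -- Only positions 0, …, m carry edges of the restriction, so exchanging the positions m and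
    -- n − 1 keeps them non-crossing and puts y (now last) next to u (still first).
    closeArc : Σ[ E′ ∈ OuterplanarEmbedding (restrict G (withinArc E y)) ] Consecutive _ E′ u y
    closeArc = E′ , inj₂ (inj₂ (trans (cong suc (trans (position-E′ y) ψ-y)) (suc-pred (n G)) ,
                                trans (position-E′ u) (trans (ψ-fix u≤m u≢y) u-first)))
      where
      H : Graph
      H = restrict G (withinArc E y)
      u≤m : position E u ≤ m
      u≤m = subst (_≤ m) (sym u-first) z≤n
      inArc : ∀ {a b} → T (adj H a b) → position E a ≤ m × position E b ≤ m
      inArc {a} {b} ab =
        let a∈ , b∈ = to T-∧ (proj₂ (to (T-∧ {adj G a b}) ab)) in ≤ᵇ⇒≤ _ _ a∈ , ≤ᵇ⇒≤ _ _ b∈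
      nc : NonCrossingℕ H ψ
      nc a b c d ab cd (ac , cb , bd) =
        let a≤ , b≤ = inArc ab ; c≤ , d≤ = inArc cd
        in noncross E a b c d (proj₁ (to (T-∧ {adj G a b}) ab)) (proj₁ (to (T-∧ {adj G c d}) cd))
             (ψ-reflects-< a≤ c≤ ac , ψ-reflects-< c≤ b≤ cb , ψ-reflects-< b≤ d≤ bd)
      embedding : Σ[ E′ ∈ OuterplanarEmbedding H ] (∀ x → position E′ x ≡ ψ x)
      embedding = reembed ψ (λ x → toℕ<n _)
        (λ eq → pos-inj E (transpose-injective (pos E y) last (toℕ-injective eq))) nc
      E′ : OuterplanarEmbedding H
      E′ = proj₁ embedding
      position-E′ : ∀ x → position E′ x ≡ ψ x
      position-E′ = proj₂ embedding

-- Paths under the chord u y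

module _ {G : Graph} (E : OuterplanarEmbedding G) {u y : Fin (n G)}
         (u-first : position E u ≡ 0) (uy : T (adj G u y)) where

  private
    m : ℕ
    m = position E y

  edge-under-chord : ∀ {x z} → 0 < position E x → position E x < m → T (adj G x z) → position E z ≤ m
  edge-under-chord {x} {z} 0<x x<m xz with position E z ≤? m
  ... | yes z≤m = z≤m
  ... | no  z≰m = contradiction (subst (_< position E x) (sym u-first) 0<x , x<m , ≰⇒> z≰m)
                                (noncross E u y x z uy xz)

  walk-under-chord : ∀ {v} x xs → position E x ≤ m → m ≤ position E v →
    T (walkToL G v (x ∷ xs)) → T (notInL u (x ∷ xs)) →
    ∃₂ λ pr sf → x ∷ xs ≡ pr ++ y ∷ sf × All (λ z → position E z < m) pr
  walk-under-chord {v} x xs x≤m m≤v w u∉ with x ≟ y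
  ... | yes refl = [] , xs , refl , []
  ... | no  x≢y  = onward xs w u∉
    where
    x<m : position E x < m
    x<m = ≤∧≢⇒< x≤m (x≢y ∘ position-injective E)

    0<x : 0 < position E x
    0<x = n≢0⇒n>0 λ x≡0 → not-does-sound (u ≟ x) (proj₁ (to T-∧ u∉))
                             (position-injective E (trans u-first (sym x≡0)))

    onward : ∀ xs → T (walkToL G v (x ∷ xs)) → T (notInL u (x ∷ xs)) →
      ∃₂ λ pr sf → x ∷ xs ≡ pr ++ y ∷ sf × All (λ z → position E z < m) pr
    onward []       w _  =
      contradiction (subst (λ v → m ≤ position E v) (sym (does-sound (x ≟ v) w)) m≤v) (<⇒≱ x<m)
    onward (z ∷ zs) w u∉ =
      let xz , w′ = to (T-∧ {adj G x z}) w
          u∉zs = proj₂ (to (T-∧ {not (does (u ≟ x))}) u∉)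
          pr , sf , eq , below = walk-under-chord z zs (edge-under-chord 0<x x<m xz) m≤v w′ u∉zs
      in x ∷ pr , sf , cong (x ∷_) eq , x<m ∷ below

firstStepWithin : {G : Graph} → OuterplanarEmbedding G → ℕ → List (Fin (n G)) → Bool
firstStepWithin E b (_ ∷ x ∷ _) = position E x ≤ᵇ b
firstStepWithin E b _           = false

splitsAt : {G : Graph} → OuterplanarEmbedding G → (u y v : Fin (n G)) → ℕ → List (Fin (n G)) → Bool
splitsAt {G} E u y v r xs =
  isPathL (restrict G (withinArc E y)) u y (List.take (2 + r) xs) ∧ isPathL G y v (y ∷ List.drop (2 + r) xs)

module _ {G : Graph} (E : OuterplanarEmbedding G) {u y v : Fin (n G)} (u-first : position E u ≡ 0) where

  private
    H : Graph
    H = restrict G (withinArc E y)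

  splitsAt-y : ∀ {xs} pr sf → xs ≡ pr ++ y ∷ sf → T (walkToL G v (u ∷ xs)) → T (distinctL (u ∷ xs)) →
    All (λ z → position E z < position E y) pr → T (splitsAt E u y v (length pr) (u ∷ xs))
  splitsAt-y pr sf refl w d below rewrite take-++-∷ pr y sf | drop-++-∷ pr y sf =
    from T-∧ ( isPathL-intro H (pr ++ y ∷ [])
                 (walkToL-restrict G (u ∷ pr ++ y ∷ []) inArc (proj₁ (walkToL-++ G (u ∷ pr) w)))
                 (proj₁ (distinctL-++⁻ (u ∷ pr ++ y ∷ [])
                          (subst (T ∘ distinctL) (sym (++-assoc (u ∷ pr) (y ∷ []) sf)) d)))
             , isPathL-intro G sf (proj₂ (walkToL-++ G (u ∷ pr) w)) (proj₂ (distinctL-++⁻ (u ∷ pr) d)))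
    where
    inArc : All (T ∘ withinArc E y) (u ∷ pr ++ y ∷ [])
    inArc = ≤⇒≤ᵇ (subst (_≤ position E y) (sym u-first) z≤n)
          ∷ ++⁺ (All.map (≤⇒≤ᵇ ∘ <⇒≤) below) (≤⇒≤ᵇ (≤-refl {position E y}) ∷ [])

module _ {G : Graph} (E : OuterplanarEmbedding G) {u y v : Fin (n G)}
         (u-first : position E u ≡ 0) (uy : T (adj G u y))
         (y≤v : position E y ≤ position E v)
         (y-max : ∀ {x} → T (adj G u x) → position E x ≤ position E v → position E x ≤ position E y)
         where

  path-splits : ∀ xs → T (isPathL G u v xs) → T (firstStepWithin E (position E v) xs) →
    ∃ λ r → 2 + r ≤ length xs × T (splitsAt E u y v r xs)
  path-splits (x ∷ x₁ ∷ rest) p first with isPathL-elim G u v x (x₁ ∷ rest) p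
  ... | refl , w , d with to (T-∧ {adj G u x₁}) w | to (T-∧ {notInL u (x₁ ∷ rest)}) d
  ... | ux₁ , w₁ | u∉ , _
    with walk-under-chord E u-first uy x₁ rest (y-max ux₁ (≤ᵇ⇒≤ _ _ first)) y≤v w₁ u∉
  ... | pr , sf , eq , below = length pr , s≤s (length-bound eq) , splitsAt-y E u-first pr sf eq w d below
    where
    length-bound : ∀ {xs} → xs ≡ pr ++ y ∷ sf → suc (length pr) ≤ length xs
    length-bound refl = begin
      suc (length pr)               ≤⟨ s≤s (m≤m+n _ _) ⟩
      suc (length pr + length sf)   ≡⟨ +-suc _ _ ⟨
      length pr + length (y ∷ sf)   ≡⟨ length-++ pr ⟨
      length (pr ++ y ∷ sf)         ∎
      where open ≤-Reasoning

PathsBoundedBy : (ℕ → ℕ) → Set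
PathsBoundedBy F =
  ∀ G → Outerplanar G → (u v : Fin (n G)) → u ≢ v → ∀ k → 1 ≤ k → numPaths G u v k ≤ F k

ConsecutivePathsBoundedBy : (ℕ → ℕ) → Set
ConsecutivePathsBoundedBy Gf = ∀ G (E : OuterplanarEmbedding G) (u v : Fin (n G)) → u ≢ v →
  Consecutive G E u v → ∀ k → 1 ≤ k → numPaths G u v k ≤ Gf k

convolution : (F Gf : ℕ → ℕ) → ℕ → ℕ
convolution F Gf k = sum (map (λ r → Gf (suc r) * F (k ∸ suc r)) (upTo k))

recSum≡2*convolution : ∀ F Gf k → recSum F Gf k ≡ 2 * convolution F Gf k
recSum≡2*convolution F Gf k = begin
  sum (map (λ r → 2 * Gf (suc r) * F (k ∸ suc r)) (upTo k))
    ≡⟨ cong sum (map-cong (λ r → *-assoc 2 (Gf (suc r)) (F (k ∸ suc r))) (upTo k)) ⟩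
  sum (map (λ r → 2 * (Gf (suc r) * F (k ∸ suc r))) (upTo k))
    ≡⟨ sum-map-*ˡ 2 (λ r → Gf (suc r) * F (k ∸ suc r)) (upTo k) ⟩
  2 * convolution F Gf k
    ∎
  where open ≡-Reasoning

arcPaths : {G : Graph} → OuterplanarEmbedding G → (u v : Fin (n G)) →
           ∀ k → Vec (Fin (n G)) (suc k) → Bool
arcPaths {G} E u v k P = isPath G u v k P ∧ firstStepWithin E (position E v) (toList P)

module _ {F Gf : ℕ → ℕ} (F-zero : 1 ≤ F 0) (F-bound : PathsBoundedBy F)
         (Gf-bound : ConsecutivePathsBoundedBy Gf) where

  pathTails≤F : ∀ {G} → Outerplanar G → ∀ y v j → count j (λ d → isPath G y v j (y ∷ d)) ≤ F j
  pathTails≤F {G} _ y v zero =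
    ≤-trans (length-filter (T? ∘ (λ d → isPath G y v zero (y ∷ d))) ([] ∷ [])) F-zero
  pathTails≤F {G} O y v (suc j) with y ≟ v
  ... | no y≢v   =
    ≤-trans (count-∷-≤ (isPath G y v (suc j)) y) (F-bound G O y v y≢v (suc j) (s≤s z≤n))
  ... | yes refl = ≤-trans (≤-reflexive (length-filterᵇ-none _ closed (allVecs (n G) (suc j)))) z≤n
    where
    closed : ∀ d → ¬ T (isPath G y y (suc j) (y ∷ d))
    closed (x ∷ d) t =
      isPathL-closed G y x (toList d) (subst T (isPath-toList G y y (suc j) (y ∷ x ∷ d)) t)

  module _ {G : Graph} (E : OuterplanarEmbedding G) {u y v : Fin (n G)}
           (u-first : position E u ≡ 0) (uy : T (adj G u y)) where

    count-splitsAt≤ : ∀ {k r} → r < k →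
      count (suc k) (splitsAt E u y v r ∘ toList) ≤ Gf (suc r) * F (k ∸ suc r)
    count-splitsAt≤ {k} {r} r<k = begin
      count (suc k) (splitsAt E u y v r ∘ toList)
        ≡⟨ cong (λ len → count len (splitsAt E u y v r ∘ toList)) (sym length≡) ⟩
      count (2 + r + j) (splitsAt E u y v r ∘ toList)
        ≡⟨ count-cong (λ w → cong₂ _∧_ (prefix w) (suffix w)) ⟩
      count (2 + r + j)
            (λ w → isPath H u y (suc r) (Vec.take (2 + r) w) ∧ isPath G y v j (y ∷ Vec.drop (2 + r) w))
        ≡⟨ count-++ (2 + r) (isPath H u y (suc r)) (λ d → isPath G y v j (y ∷ d)) ⟩
      numPaths H u y (suc r) * count j (λ d → isPath G y v j (y ∷ d))
        ≤⟨ *-mono-≤ (Gf-bound H (proj₁ arc) u y u≢y (proj₂ arc) (suc r) (s≤s z≤n))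
                    (pathTails≤F E y v j) ⟩
      Gf (suc r) * F j
        ∎
      where
      open ≤-Reasoning
      H : Graph
      H = restrict G (withinArc E y)
      j : ℕ
      j = k ∸ suc r
      u≢y : u ≢ y
      u≢y refl = subst T (irrefl G u) uy
      arc : Σ[ E′ ∈ OuterplanarEmbedding H ] Consecutive H E′ u y
      arc = closeArc E u-first u≢y
      length≡ : 2 + r + j ≡ suc k
      length≡ = cong suc (m+[n∸m]≡n r<k)
      prefix : ∀ w →
        isPathL H u y (List.take (2 + r) (toList w)) ≡ isPath H u y (suc r) (Vec.take (2 + r) w)
      prefix w = sym (trans (isPath-toList H u y (suc r) (Vec.take (2 + r) w))
                            (cong (isPathL H u y) (toList-take (2 + r) w)))
      suffix : ∀ w →
        isPathL G y v (y ∷ List.drop (2 + r) (toList w)) ≡ isPath G y v j (y ∷ Vec.drop (2 + r) w)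
      suffix w = sym (trans (isPath-toList G y v j (y ∷ Vec.drop (2 + r) w))
                            (cong (isPathL G y v ∘ (y ∷_)) (toList-drop (2 + r) w)))

  count-arcPaths≤ : ∀ {G} (E : OuterplanarEmbedding G) {u v} → position E u ≡ 0 → ∀ k →
    count (suc k) (arcPaths E u v k) ≤ convolution F Gf k
  count-arcPaths≤ {G} E {u} {v} u-first k
    with maximum? (λ x → adj G u x ∧ (position E x ≤ᵇ position E v)) (position E)
  ... | inj₁ none = ≤-trans (≤-reflexive (length-filterᵇ-none _ noArcPath (allVecs (n G) (suc k)))) z≤n
    where
    noArcPath : ∀ P → ¬ T (arcPaths E u v k P)
    noArcPath (x ∷ [])     t = proj₂ (to (T-∧ {isPath G u v _ (x ∷ [])}) t)
    noArcPath (x ∷ x₁ ∷ P) t with to (T-∧ {isPath G u v _ (x ∷ x₁ ∷ P)}) t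
    ... | p , first
      with isPathL-elim G u v x (x₁ ∷ toList P) (subst T (isPath-toList G u v _ (x ∷ x₁ ∷ P)) p)
    ... | refl , w , _ = none x₁ (from T-∧ (proj₁ (to (T-∧ {adj G u x₁}) w) , first))
  ... | inj₂ (y , uy∧y≤v , y-max) = begin
      count (suc k) (arcPaths E u v k)
        ≤⟨ length-filterᵇ-cover _ (λ r → splitsAt E u y v r ∘ toList) (upTo k) cover
                                (allVecs (n G) (suc k)) ⟩
      sum (map (λ r → count (suc k) (splitsAt E u y v r ∘ toList)) (upTo k))
        ≤⟨ sum-map-mono (upTo k) (λ r∈ → count-splitsAt≤ E u-first uy (∈-upTo⁻ r∈)) ⟩
      convolution F Gf k
        ∎
    where
    open ≤-Reasoning
    uy : T (adj G u y)
    uy = proj₁ (to (T-∧ {adj G u y}) uy∧y≤v)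
    y≤v : position E y ≤ position E v
    y≤v = ≤ᵇ⇒≤ _ _ (proj₂ (to (T-∧ {adj G u y}) uy∧y≤v))
    y-max′ : ∀ {x} → T (adj G u x) → position E x ≤ position E v → position E x ≤ position E y
    y-max′ ux x≤v = y-max _ (from T-∧ (ux , ≤⇒≤ᵇ x≤v))
    cover : ∀ P → T (arcPaths E u v k P) → Any (λ r → T (splitsAt E u y v r (toList P))) (upTo k)
    cover P t =
      let p , first = to (T-∧ {isPath G u v k P}) t
          r , r+2≤ , split =
            path-splits E u-first uy y≤v y-max′ (toList P) (subst T (isPath-toList G u v k P) p) first
      in lose (∈-upTo⁺ (s≤s⁻¹ (subst (2 + r ≤_) (length-toList P) r+2≤))) split

  numPaths≤2*convolution : ∀ {G} (E : OuterplanarEmbedding G) {u v} → position E u ≡ 0 → u ≢ v → ∀ k →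
    numPaths G u v (suc k) ≤ 2 * convolution F Gf (suc k)
  numPaths≤2*convolution {G} E {u} {v} u-first u≢v k =
    ≤-trans (length-filterᵇ-cover _ (λ E → arcPaths E u v (suc k)) (E ∷ E′ ∷ []) eitherArc
                                  (allVecs (n G) (suc (suc k))))
            (+-mono-≤ (count-arcPaths≤ E u-first (suc k))
                      (+-mono-≤ (count-arcPaths≤ E′ u-first′ (suc k)) ≤-refl))
    where
    E′ : OuterplanarEmbedding G
    E′ = proj₁ (reflect E)
    position-E′ : ∀ x → position E′ x ≡ cyclicNeg (n G) (position E x)
    position-E′ = proj₂ (reflect E)
    u-first′ : position E′ u ≡ 0
    u-first′ = trans (position-E′ u) (cong (cyclicNeg (n G)) u-first)
    0<v : 0 < position E v
    0<v = n≢0⇒n>0 λ v≡0 → u≢v (position-injective E (trans u-first (sym v≡0)))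
    eitherArc : ∀ P → T (isPath G u v (suc k) P) →
                Any (λ E → T (arcPaths E u v (suc k) P)) (E ∷ E′ ∷ [])
    eitherArc (x ∷ x₁ ∷ _) p with position E x₁ ≤? position E v
    ... | yes x₁≤v = here (from T-∧ (p , ≤⇒≤ᵇ x₁≤v))
    ... | no  x₁≰v = there (here (from T-∧ (p , ≤⇒≤ᵇ x₁≤′v)))
      where
      x₁≤′v : position E′ x₁ ≤ position E′ v
      x₁≤′v = subst₂ _≤_ (sym (position-E′ x₁)) (sym (position-E′ v))
                        (cyclicNeg-antitone (n G) 0<v (≰⇒> x₁≰v))

mainTheorem8 : (F Gf : ℕ → ℕ) → IsF F → IsG Gf → (k : ℕ) → 1 ≤ k → F k ≤ recSum F Gf k
mainTheorem8 F Gf isF isG (suc k) _ with proj₂ (proj₂ isF (suc k) (s≤s z≤n))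
... | G , E , u , v , u≢v , paths≡F = begin
  F (suc k)                     ≡⟨ paths≡F ⟨
  numPaths G u v (suc k)        ≤⟨ numPaths≤2*convolution F-zero F-bound Gf-bound E₀ u-first u≢v k ⟩
  2 * convolution F Gf (suc k)  ≡⟨ recSum≡2*convolution F Gf (suc k) ⟨
  recSum F Gf (suc k)           ∎
  where
  open ≤-Reasoning
  E₀ : OuterplanarEmbedding G
  E₀ = proj₁ (placeFirst E u)
  u-first : position E₀ u ≡ 0
  u-first = proj₂ (placeFirst E u)
  F-zero : 1 ≤ F 0
  F-zero = ≤-reflexive (sym (proj₁ isF))
  F-bound : PathsBoundedBy F
  F-bound G O u v u≢v k 1≤k = proj₁ (proj₂ isF k 1≤k) G O u v u≢v
  Gf-bound : ConsecutivePathsBoundedBy Gf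
  Gf-bound G E u v u≢v c k 1≤k = proj₁ (isG k 1≤k) G E u v u≢v c
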